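{- Let $n>5$ be odd and $U=V(n,2)$ with a nondegenerate symmetric bilinear form $\mathsf b$. Then a DHO-set $\Delta\subseteq\mathrm{End}(U)$ is the shadow of at most one additively closed symplectic spread-set of $U$.
   Context: Operators act on the right; $xE_{a,b}=\mathsf b(x,a)b$; $T$ is skew-symmetric if self-adjoint and $\mathsf b(x,xT)=0$ for all $x$. A symplectic spread-set of $U$ is a set $\Sigma$ of $2^n$ self-adjoint operators containing $0$ with $L+L'$ invertible for distinct members; its canonical labeling is the unique bijection $C:U\to\Sigma$ with $C(a)+E_{a,a}$ skew-symmetric for every $a$, and its shadow is $\Delta_\Sigma=\{C(a)+E_{a,a}\mid a\in U\}$. A DHO-set is a set $\Delta$ of skew-symmetric operators such that $\{\{(x,xL)\mid x\in U\}\mid L\in\Delta\}$ is an orthogonal dual hyperoval of $U\oplus U$ (quadratic form $Q(x,y)=\mathsf b(x,y)$) splitting over $0\oplus U$. -}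

module Defs where

open import Data.Bool using (Bool; true; false; _xor_; if_then_else_)
open import Data.Nat using (ℕ; _^_)
open import Data.Vec using (Vec; []; _∷_; replicate; zipWith; map; tabulate)
open import Data.Fin using (Fin; _≟_)
open import Data.List using (List; length; foldr)
import Data.List as L
open import Data.List.Membership.Propositional using (_∈_)
open import Data.List.Relation.Unary.All using (All)
open import Data.List.Relation.Unary.Unique.Propositional using (Unique)
open import Data.Product using (Σ; ∃; ∃-syntax; _×_; _,_)
open import Data.Sum using (_⊎_)
open import Relation.Binary.PropositionalEquality using (_≡_; _≢_)
open import Relation.Nullary using (¬_; does)
open import Function.Bundles using (_⇔_)

-- The vector space U = V(n,2) = GF(2)^n, GF(2) = Bool (xor, and)

Vect : ℕ → Set
Vect n = Vec Bool n

𝟎 : ∀ {n} → Vect n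
𝟎 = replicate _ false

infixl 6 _⊕_
_⊕_ : ∀ {n} → Vect n → Vect n → Vect n
_⊕_ = zipWith _xor_

e : ∀ {n} → Fin n → Vect n
e i = tabulate (λ j → does (i ≟ j))

-- Operators on U, acting on the right, as n×n matrices (list of rows):
-- x·M = Σ_i x_i (row i of M).

Op : ℕ → Set
Op n = Vec (Vect n) n

vm : ∀ {m n} → Vect m → Vec (Vect n) m → Vect n
vm []       []      = 𝟎
vm (xi ∷ x) (r ∷ M) = (if xi then r else 𝟎) ⊕ vm x M

infixl 7 _·_
_·_ : ∀ {n} → Vect n → Op n → Vect n
x · M = vm x M

-- composition "first M then N":  x (M ∘ N) = (x M) N
_∘ₒ_ : ∀ {n} → Op n → Op n → Op n
M ∘ₒ N = map (λ r → r · N) M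

idOp : ∀ {n} → Op n
idOp = tabulate e

zeroOp : ∀ {n} → Op n
zeroOp = replicate _ 𝟎

infixl 6 _⊞_
_⊞_ : ∀ {n} → Op n → Op n → Op n
_⊞_ = zipWith _⊕_

Invertible : ∀ {n} → Op n → Set
Invertible M = ∃[ N ] (M ∘ₒ N ≡ idOp × N ∘ₒ M ≡ idOp)

record NondegSymBilinear (n : ℕ) (b : Vect n → Vect n → Bool) : Set where
  field
    additiveˡ  : ∀ x y z → b (x ⊕ y) z ≡ b x z xor b y z
    symmetric  : ∀ x y → b x y ≡ b y x
    nondegen   : ∀ x → (∀ y → b x y ≡ false) → x ≡ 𝟎

module _ {n : ℕ} (b : Vect n → Vect n → Bool) where

  SelfAdjoint : Op n → Set
  SelfAdjoint T = ∀ x y → b (x · T) y ≡ b x (y · T)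

  SkewSymmetric : Op n → Set
  SkewSymmetric T = SelfAdjoint T × (∀ x → b x (x · T) ≡ false)

  -- E_{a,c} : x ↦ b(x,a) c   (matrix whose i-th row is e_i E_{a,c})
  E : Vect n → Vect n → Op n
  E a c = map (λ r → if b r a then c else 𝟎) idOp

  -- Finite sets of operators are duplicate-free lists.

  record SymplecticSpreadSet (Σs : List (Op n)) : Set where
    field
      unique     : Unique Σs
      card       : length Σs ≡ 2 ^ n
      hasZero    : zeroOp ∈ Σs
      selfAdj    : ∀ L → L ∈ Σs → SelfAdjoint L
      sumInvert  : ∀ L L' → L ∈ Σs → L' ∈ Σs → L ≢ L' → Invertible (L ⊞ L')

  AdditivelyClosed : List (Op n) → Set
  AdditivelyClosed Σs = ∀ L L' → L ∈ Σs → L' ∈ Σs → (L ⊞ L') ∈ Σs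

  IsCanonicalLabeling : List (Op n) → (Vect n → Op n) → Set
  IsCanonicalLabeling Σs C =
      (∀ a → C a ∈ Σs)
    × (∀ a a' → C a ≡ C a' → a ≡ a')
    × (∀ L → L ∈ Σs → ∃[ a ] C a ≡ L)
    × (∀ a → SkewSymmetric (C a ⊞ E a a))

  IsShadowOf : List (Op n) → List (Op n) → Set
  IsShadowOf Δ Σs = ∃[ C ] (IsCanonicalLabeling Σs C
                       × (∀ M → (M ∈ Δ) ⇔ (∃[ a ] M ≡ C a ⊞ E a a)))

  -- U ⊕ U with quadratic form Q(x,y) = b(x,y); subspaces as predicates.

  V2 : Set
  V2 = Vect n × Vect n

  𝟎₂ : V2
  𝟎₂ = 𝟎 , 𝟎

  _⊕₂_ : V2 → V2 → V2
  (x , y) ⊕₂ (x' , y') = (x ⊕ x') , (y ⊕ y')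

  Q : V2 → Bool
  Q (x , y) = b x y

  Pred2 : Set₁
  Pred2 = V2 → Set

  graph : Op n → Pred2
  graph L (x , y) = y ≡ x · L

  W₀ : Pred2
  W₀ (x , _) = x ≡ 𝟎

  _∩_ : Pred2 → Pred2 → Pred2
  (P ∩ P') v = P v × P' v

  -- a subspace over GF(2) is 1-dimensional iff it has exactly one nonzero vector
  OneDim : Pred2 → Set
  OneDim P = ∃[ v ] (v ≢ 𝟎₂ × P v × (∀ w → P w → w ≡ 𝟎₂ ⊎ w ≡ v))

  Trivial : Pred2 → Set
  Trivial P = ∀ w → P w → w ≡ 𝟎₂

  TotallySingular : Pred2 → Set
  TotallySingular P = ∀ v → P v → Q v ≡ false

  Complement : Pred2 → Pred2 → Set
  Complement X W = Trivial (X ∩ W) × (∀ v → ∃[ x ] ∃[ w ] (X x × W w × v ≡ x ⊕₂ w))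

  sum₂ : List V2 → V2
  sum₂ = foldr _⊕₂_ 𝟎₂

  -- Δ is a DHO-set: Δ consists of skew-symmetric operators and
  -- { graph L | L ∈ Δ } is an orthogonal dual hyperoval of (U ⊕ U, Q)
  -- splitting over 0 ⊕ U.  (Each graph is an n-dimensional subspace;
  -- Δ ↦ graphs is injective, so the family has |Δ| members.)
  record DHOSet (Δ : List (Op n)) : Set where
    field
      unique     : Unique Δ
      skew       : ∀ L → L ∈ Δ → SkewSymmetric L
      -- dual hyperoval of rank n: 2^n members
      card       : length Δ ≡ 2 ^ n
      pairs      : ∀ L L' → L ∈ Δ → L' ∈ Δ → L ≢ L'
                   → OneDim (graph L ∩ graph L')
      triples    : ∀ L L' L'' → L ∈ Δ → L' ∈ Δ → L'' ∈ Δ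
                   → L ≢ L' → L ≢ L'' → L' ≢ L''
                   → Trivial (graph L ∩ (graph L' ∩ graph L''))
      spanning   : ∀ v → ∃[ ws ] (All (λ w → ∃[ L ] (L ∈ Δ × graph L w)) ws
                                  × v ≡ sum₂ ws)
      orthogonal : ∀ L → L ∈ Δ → TotallySingular (graph L)
      splitting  : ∀ L → L ∈ Δ → Complement (graph L) W₀

-- Let C₁, C₂ be the canonical labelings of two additively closed spread-sets with the
-- same shadow, and let π : U → U satisfy C₂(a) + E_{a,a} = C₁(πa) + E_{πa,πa}.
-- Since the canonical labeling is recovered from the quadratic form x ↦ b(x, x C(a)) = b(x, a),
-- additive closure makes each Cᵢ additive.  Comparing x C₁(πa + πa' + π(a+a')) with the
-- C₂-side, the operator C₁(πa + πa' + π(a+a')) kills every x orthogonal to the six vectors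
-- a, πa, a', πa', a+a', π(a+a'); as n ≥ 7 such a nonzero x exists, and a nonzero member of
-- a spread-set is invertible, so π is additive.  Evaluating the same identity at a nonzero x
-- orthogonal to a and πa, and at a' with b(x, a') = 1, forces πa = a.  Hence C₁ = C₂.
module Submission where

open import Defs
open import Data.Bool using (Bool; true; false; _xor_; _∧_; if_then_else_)
open import Data.Bool.Properties using (xor-assoc; xor-comm; xor-same; xor-identityʳ; ∧-idem)
  renaming (_≟_ to _≟ᵇ_)
open import Data.Empty using (⊥-elim)
open import Data.Fin using (Fin; zero; suc)
open import Data.Fin.Properties using (2↔Bool; pigeonhole; <⇒≢)
open import Data.Fin.Subset.Properties using (anySubset?)
open import Data.List using (List)
open import Data.List.Membership.Propositional using (_∈_)
open import Data.Nat using (ℕ; _<_; _^_; s≤s; z≤n)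
open import Data.Nat.DivMod using (_%_)
open import Data.Nat.Properties using (≤∧≢⇒<; 0≢1+n; ^-monoʳ-<; <-trans)
open import Data.Product using (∃; ∃₂; ∃-syntax; _×_; _,_; proj₁; proj₂)
open import Data.Vec using (Vec; []; _∷_; replicate; zipWith; map; tabulate)
open import Data.Vec.Properties
  using (zipWith-assoc; zipWith-comm; zipWith-identityˡ; zipWith-identityʳ; tabulate-∘; ∷-injective; ≡-dec)
open import Data.Vec.Recursive using (Fin[m^n]↔Fin[m]^n; lift↔)
open import Data.Vec.Recursive.Properties using (↔Vec)
open import Data.Vec.Relation.Unary.All using (All; []; _∷_)
open import Function.Bundles using (_⇔_; _↔_; _↣_; mk⇔; Injection; Equivalence)
open import Function.Properties.Inverse using (↔-sym; ↔-trans; ↔⇒↣)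
open import Relation.Binary.PropositionalEquality
open import Relation.Nullary using (¬_; yes; no)

private variable
  k m n : ℕ

-- GF(2)^n as an elementary abelian 2-group

xor≡false⇒≡ : (β γ : Bool) → β xor γ ≡ false → β ≡ γ
xor≡false⇒≡ true  true  _ = refl
xor≡false⇒≡ false false _ = refl

⊕-assoc : (x y z : Vect n) → (x ⊕ y) ⊕ z ≡ x ⊕ (y ⊕ z)
⊕-assoc = zipWith-assoc xor-assoc

⊕-comm : (x y : Vect n) → x ⊕ y ≡ y ⊕ x
⊕-comm = zipWith-comm xor-comm

⊕-identityˡ : (x : Vect n) → 𝟎 ⊕ x ≡ x
⊕-identityˡ = zipWith-identityˡ λ _ → refl

⊕-identityʳ : (x : Vect n) → x ⊕ 𝟎 ≡ x
⊕-identityʳ = zipWith-identityʳ xor-identityʳ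

⊕-self : (x : Vect n) → x ⊕ x ≡ 𝟎
⊕-self []      = refl
⊕-self (a ∷ x) = cong₂ _∷_ (xor-same a) (⊕-self x)

⊕-cancelˡ : (x y : Vect n) → x ⊕ (x ⊕ y) ≡ y
⊕-cancelˡ x y = begin
  x ⊕ (x ⊕ y) ≡⟨ ⊕-assoc x x y ⟨
  (x ⊕ x) ⊕ y ≡⟨ cong (_⊕ y) (⊕-self x) ⟩
  𝟎 ⊕ y       ≡⟨ ⊕-identityˡ y ⟩
  y           ∎
  where open ≡-Reasoning

⊕-cancelʳ : (x y : Vect n) → (x ⊕ y) ⊕ y ≡ x
⊕-cancelʳ x y = trans (⊕-comm (x ⊕ y) y) (trans (cong (y ⊕_) (⊕-comm x y)) (⊕-cancelˡ y x))

⊕≡𝟎⇒≡ : (x y : Vect n) → x ⊕ y ≡ 𝟎 → x ≡ y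
⊕≡𝟎⇒≡ x y x⊕y≡𝟎 = begin
  x           ≡⟨ ⊕-identityʳ x ⟨
  x ⊕ 𝟎       ≡⟨ cong (x ⊕_) x⊕y≡𝟎 ⟨
  x ⊕ (x ⊕ y) ≡⟨ ⊕-cancelˡ x y ⟩
  y           ∎
  where open ≡-Reasoning

⊕-interchange : (w x y z : Vect n) → (w ⊕ x) ⊕ (y ⊕ z) ≡ (w ⊕ y) ⊕ (x ⊕ z)
⊕-interchange w x y z = begin
  (w ⊕ x) ⊕ (y ⊕ z) ≡⟨ ⊕-assoc w x (y ⊕ z) ⟩
  w ⊕ (x ⊕ (y ⊕ z)) ≡⟨ cong (w ⊕_) (⊕-assoc x y z) ⟨
  w ⊕ ((x ⊕ y) ⊕ z) ≡⟨ cong (λ t → w ⊕ (t ⊕ z)) (⊕-comm x y) ⟩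
  w ⊕ ((y ⊕ x) ⊕ z) ≡⟨ cong (w ⊕_) (⊕-assoc y x z) ⟩
  w ⊕ (y ⊕ (x ⊕ z)) ≡⟨ ⊕-assoc w y (x ⊕ z) ⟨
  (w ⊕ y) ⊕ (x ⊕ z) ∎
  where open ≡-Reasoning

⊕-interchange₃ : (p q p' q' p'' q'' : Vect n) →
                 ((p ⊕ q) ⊕ (p' ⊕ q')) ⊕ (p'' ⊕ q'') ≡ ((p ⊕ p') ⊕ p'') ⊕ ((q ⊕ q') ⊕ q'')
⊕-interchange₃ p q p' q' p'' q'' =
  trans (cong (_⊕ (p'' ⊕ q'')) (⊕-interchange p q p' q')) (⊕-interchange (p ⊕ p') (q ⊕ q') p'' q'')

additive-sum≡𝟎 : (u v w : Vect n) → w ≡ u ⊕ v → (u ⊕ v) ⊕ w ≡ 𝟎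
additive-sum≡𝟎 u v w refl = ⊕-self (u ⊕ v)

⊞-cancelʳ : (M N K : Vec (Vect n) m) → zipWith _⊕_ M K ≡ zipWith _⊕_ N K → M ≡ N
⊞-cancelʳ []      []      []      _  = refl
⊞-cancelʳ (r ∷ M) (s ∷ N) (t ∷ K) eq = cong₂ _∷_ r≡s (⊞-cancelʳ M N K (proj₂ (∷-injective eq)))
  where
  r≡s : r ≡ s
  r≡s = trans (sym (⊕-cancelʳ r t)) (trans (cong (_⊕ t) (proj₁ (∷-injective eq))) (⊕-cancelʳ s t))

-- Scalar multiplication and the action of matrices

scale : Bool → Vect n → Vect n
scale β v = if β then v else 𝟎

scale-𝟎 : (β : Bool) → scale β (𝟎 {n}) ≡ 𝟎
scale-𝟎 true  = refl
scale-𝟎 false = refl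

scale-xor : (β γ : Bool) (v : Vect n) → scale β v ⊕ scale γ v ≡ scale (β xor γ) v
scale-xor true  true  v = ⊕-self v
scale-xor true  false v = ⊕-identityʳ v
scale-xor false γ     v = ⊕-identityˡ (scale γ v)

scale-⊕ : (β : Bool) (u v : Vect n) → scale β (u ⊕ v) ≡ scale β u ⊕ scale β v
scale-⊕ true  u v = refl
scale-⊕ false u v = sym (⊕-identityˡ 𝟎)

vm-𝟎 : (M : Vec (Vect n) m) → vm 𝟎 M ≡ 𝟎
vm-𝟎 []      = refl
vm-𝟎 (r ∷ M) = trans (⊕-identityˡ (vm 𝟎 M)) (vm-𝟎 M)

vm-zeroOp : (x : Vect m) → vm x (replicate m (𝟎 {n})) ≡ 𝟎
vm-zeroOp []      = refl
vm-zeroOp (a ∷ x) = trans (cong₂ _⊕_ (scale-𝟎 a) (vm-zeroOp x)) (⊕-identityˡ 𝟎)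

vm-scale : (β : Bool) (r : Vect m) (N : Vec (Vect n) m) → vm (scale β r) N ≡ scale β (vm r N)
vm-scale true  r N = refl
vm-scale false r N = vm-𝟎 N

vm-⊕ : (x y : Vect m) (M : Vec (Vect n) m) → vm (x ⊕ y) M ≡ vm x M ⊕ vm y M
vm-⊕ []      []      []      = sym (⊕-identityˡ 𝟎)
vm-⊕ (a ∷ x) (c ∷ y) (r ∷ M) =
  trans (cong₂ _⊕_ (sym (scale-xor a c r)) (vm-⊕ x y M))
        (⊕-interchange (scale a r) (scale c r) (vm x M) (vm y M))

vm-⊞ : (x : Vect m) (M N : Vec (Vect n) m) → vm x (zipWith _⊕_ M N) ≡ vm x M ⊕ vm x N
vm-⊞ []      []      []      = sym (⊕-identityˡ 𝟎)
vm-⊞ (a ∷ x) (r ∷ M) (s ∷ N) =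
  trans (cong₂ _⊕_ (scale-⊕ a r s) (vm-⊞ x M N))
        (⊕-interchange (scale a r) (scale a s) (vm x M) (vm x N))

vm-∘ : ∀ {l} (x : Vect m) (M : Vec (Vect n) m) (N : Vec (Vect l) n) →
       vm x (map (λ r → vm r N) M) ≡ vm (vm x M) N
vm-∘ []      []      N = sym (vm-𝟎 N)
vm-∘ (a ∷ x) (r ∷ M) N =
  trans (cong₂ _⊕_ (sym (vm-scale a r N)) (vm-∘ x M N)) (sym (vm-⊕ (scale a r) (vm x M) N))

vm-prepend-false : (x : Vect m) (R : Vec (Vect n) m) → vm x (map (false ∷_) R) ≡ false ∷ vm x R
vm-prepend-false []      []      = refl
vm-prepend-false (a ∷ x) (r ∷ R) = cong₂ _⊕_ (scale-prepend-false a) (vm-prepend-false x R)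
  where
  scale-prepend-false : ∀ β → scale β (false ∷ r) ≡ false ∷ scale β r
  scale-prepend-false true  = refl
  scale-prepend-false false = refl

e-zero : e {ℕ.suc n} zero ≡ true ∷ 𝟎
e-zero = cong (true ∷_) (tabulate-const false)
  where
  tabulate-const : ∀ {n} β → tabulate {n} (λ _ → β) ≡ replicate n β
  tabulate-const {ℕ.zero} β = refl
  tabulate-const {ℕ.suc n} β = cong (β ∷_) (tabulate-const β)

·-idOp : (x : Vect n) → x · idOp ≡ x
·-idOp []      = refl
·-idOp (a ∷ x) = begin
  scale a (e zero) ⊕ vm x (tabulate (λ i → e (suc i)))
    ≡⟨ cong₂ (λ r R → scale a r ⊕ vm x R) e-zero (tabulate-∘ (false ∷_) e) ⟩
  scale a (true ∷ 𝟎) ⊕ vm x (map (false ∷_) idOp)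
    ≡⟨ cong (scale a (true ∷ 𝟎) ⊕_) (vm-prepend-false x idOp) ⟩
  scale a (true ∷ 𝟎) ⊕ (false ∷ x · idOp)
    ≡⟨ head-and-tail a ⟩
  a ∷ x ∎
  where
  open ≡-Reasoning
  head-and-tail : ∀ β → scale β (true ∷ 𝟎) ⊕ (false ∷ x · idOp) ≡ β ∷ x
  head-and-tail true  = cong (true ∷_)  (trans (⊕-identityˡ (x · idOp)) (·-idOp x))
  head-and-tail false = cong (false ∷_) (trans (⊕-identityˡ (x · idOp)) (·-idOp x))

-- Counting in GF(2)^n

Fin[2^n]↔Vect : Fin (2 ^ n) ↔ Vect n
Fin[2^n]↔Vect {n} = ↔-trans (Fin[m^n]↔Fin[m]^n 2 n) (↔-trans (lift↔ n 2↔Bool) (↔Vec n))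

↣-pigeonhole : {A B : Set} → Fin m ↣ A → B ↣ Fin k → k < m →
               (f : A → B) → ∃₂ λ x y → x ≢ y × f x ≡ f y
↣-pigeonhole Fin↣A B↣Fin k<m f =
  let i , j , i<j , eq = pigeonhole k<m (λ i → B.to (f (A.to i)))
  in A.to i , A.to j , (λ eq′ → <⇒≢ i<j (A.injective eq′)) , B.injective eq
  where
  module A = Injection Fin↣A
  module B = Injection B↣Fin

Vect-pigeonhole : k < n → (f : Vect n → Vect k) → ∃₂ λ x y → x ≢ y × f x ≡ f y
Vect-pigeonhole k<n =
  ↣-pigeonhole (↔⇒↣ Fin[2^n]↔Vect) (↔⇒↣ (↔-sym Fin[2^n]↔Vect)) (^-monoʳ-< 2 (s≤s (s≤s z≤n)) k<n)

module NondegSymBilinearProperties {b : Vect n → Vect n → Bool} (B : NondegSymBilinear n b) where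
  open NondegSymBilinear B

  zeroˡ : ∀ y → b 𝟎 y ≡ false
  zeroˡ y = begin
    b 𝟎 y               ≡⟨ cong (λ t → b t y) (⊕-self 𝟎) ⟨
    b (𝟎 ⊕ 𝟎) y         ≡⟨ additiveˡ 𝟎 𝟎 y ⟩
    b 𝟎 y xor b 𝟎 y     ≡⟨ xor-same (b 𝟎 y) ⟩
    false               ∎
    where open ≡-Reasoning

  zeroʳ : ∀ x → b x 𝟎 ≡ false
  zeroʳ x = trans (symmetric x 𝟎) (zeroˡ x)

  additiveʳ : ∀ x y z → b x (y ⊕ z) ≡ b x y xor b x z
  additiveʳ x y z =
    trans (symmetric x (y ⊕ z)) (trans (additiveˡ y z x) (cong₂ _xor_ (symmetric y x) (symmetric z x)))

  scaleʳ : ∀ x β c → b x (scale β c) ≡ β ∧ b x c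
  scaleʳ x true  c = refl
  scaleʳ x false c = zeroʳ x

  ≡-by-form : ∀ u v → (∀ x → b x u ≡ b x v) → u ≡ v
  ≡-by-form u v h = ⊕≡𝟎⇒≡ u v (nondegen (u ⊕ v) λ y → begin
    b (u ⊕ v) y         ≡⟨ additiveˡ u v y ⟩
    b u y xor b v y     ≡⟨ cong₂ _xor_ (symmetric u y) (symmetric v y) ⟩
    b y u xor b y v     ≡⟨ cong (_xor b y v) (h y) ⟩
    b y v xor b y v     ≡⟨ xor-same (b y v) ⟩
    false               ∎)
    where open ≡-Reasoning

  ∃-non-orthogonal : ∀ v → v ≢ 𝟎 → ∃[ y ] b v y ≡ true
  ∃-non-orthogonal v v≢𝟎 with anySubset? (λ y → b v y ≟ᵇ true)
  ... | yes witness = witness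
  ... | no ¬witness = ⊥-elim (v≢𝟎 (nondegen v λ y → ¬true⇒false (λ eq → ¬witness (y , eq))))
    where
    ¬true⇒false : ∀ {β} → ¬ β ≡ true → β ≡ false
    ¬true⇒false {true}  ¬t = ⊥-elim (¬t refl)
    ¬true⇒false {false} _  = refl

  ∃-nonzero-orthogonal : k < n → (us : Vec (Vect n) k) →
                         ∃[ y ] y ≢ 𝟎 × All (λ u → b y u ≡ false) us
  ∃-nonzero-orthogonal k<n us =
    let x , x′ , x≢x′ , eq = Vect-pigeonhole k<n (λ y → map (b y) us)
    in x ⊕ x′ , (λ x⊕x′≡𝟎 → x≢x′ (⊕≡𝟎⇒≡ x x′ x⊕x′≡𝟎)) , orthogonal x x′ us eq
    where
    orthogonal : ∀ {k} x x′ (us : Vec (Vect n) k) → map (b x) us ≡ map (b x′) us →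
                 All (λ u → b (x ⊕ x′) u ≡ false) us
    orthogonal x x′ []       _  = []
    orthogonal x x′ (u ∷ us) eq =
      trans (additiveˡ x x′ u) (trans (cong (_xor b x′ u) (proj₁ (∷-injective eq))) (xor-same (b x′ u)))
      ∷ orthogonal x x′ us (proj₂ (∷-injective eq))

  vm-rank-one : ∀ {m} (x : Vect m) (R : Vec (Vect n) m) (a c : Vect n) →
                vm x (map (λ r → scale (b r a) c) R) ≡ scale (b (vm x R) a) c
  vm-rank-one []      []      a c = cong (λ β → scale β c) (sym (zeroˡ a))
  vm-rank-one (β ∷ x) (r ∷ R) a c = begin
    scale β (scale (b r a) c) ⊕ vm x (map (λ r → scale (b r a) c) R)
      ≡⟨ cong₂ _⊕_ (scale-scale β) (vm-rank-one x R a c) ⟩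
    scale (b (scale β r) a) c ⊕ scale (b (vm x R) a) c
      ≡⟨ scale-xor (b (scale β r) a) (b (vm x R) a) c ⟩
    scale (b (scale β r) a xor b (vm x R) a) c
      ≡⟨ cong (λ γ → scale γ c) (additiveˡ (scale β r) (vm x R) a) ⟨
    scale (b (scale β r ⊕ vm x R) a) c ∎
    where
    open ≡-Reasoning
    scale-scale : ∀ β → scale β (scale (b r a) c) ≡ scale (b (scale β r) a) c
    scale-scale true  = refl
    scale-scale false = cong (λ γ → scale γ c) (sym (zeroˡ a))

  ·-E : ∀ x a c → x · E b a c ≡ scale (b x a) c
  ·-E x a c = trans (vm-rank-one x idOp a c) (cong (λ y → scale (b y a) c) (·-idOp x))

invertible-kernel : ∀ {M : Op n} {y} → Invertible M → y · M ≡ 𝟎 → y ≡ 𝟎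
invertible-kernel {M = M} {y} (M⁻¹ , M∘M⁻¹≡id , _) yM≡𝟎 = begin
  y              ≡⟨ ·-idOp y ⟨
  y · idOp       ≡⟨ cong (y ·_) M∘M⁻¹≡id ⟨
  y · (M ∘ₒ M⁻¹) ≡⟨ vm-∘ y M M⁻¹ ⟩
  (y · M) · M⁻¹  ≡⟨ cong (_· M⁻¹) yM≡𝟎 ⟩
  𝟎 · M⁻¹        ≡⟨ vm-𝟎 M⁻¹ ⟩
  𝟎              ∎
  where open ≡-Reasoning

singular-member≡zeroOp : {b : Vect n → Vect n → Bool} {Σs : List (Op n)} →
                         SymplecticSpreadSet b Σs → ∀ {L y} → L ∈ Σs →
                         y ≢ 𝟎 → y · L ≡ 𝟎 → L ≡ zeroOp
singular-member≡zeroOp S {L} {y} L∈Σ y≢𝟎 yL≡𝟎 with ≡-dec (≡-dec _≟ᵇ_) L zeroOp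
... | yes L≡0 = L≡0
... | no  L≢0 = ⊥-elim (y≢𝟎 (invertible-kernel (sumInvert L zeroOp L∈Σ hasZero L≢0) y[L+0]≡𝟎))
  where
  open SymplecticSpreadSet S
  y[L+0]≡𝟎 : y · (L ⊞ zeroOp) ≡ 𝟎
  y[L+0]≡𝟎 = trans (vm-⊞ y L zeroOp) (trans (cong₂ _⊕_ yL≡𝟎 (vm-zeroOp y)) (⊕-identityˡ 𝟎))

module CanonicalLabeling {b : Vect n → Vect n → Bool} (B : NondegSymBilinear n b)
  {Σs : List (Op n)} (S : SymplecticSpreadSet b Σs) (closed : AdditivelyClosed b Σs)
  {C : Vect n → Op n} (isC : IsCanonicalLabeling b Σs C) where
  open NondegSymBilinearProperties B

  C-∈ : ∀ a → C a ∈ Σs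
  C-∈ = proj₁ isC

  C-injective : ∀ a a' → C a ≡ C a' → a ≡ a'
  C-injective = proj₁ (proj₂ isC)

  C-surjective : ∀ L → L ∈ Σs → ∃[ a ] C a ≡ L
  C-surjective = proj₁ (proj₂ (proj₂ isC))

  C⊞E-skew : ∀ a → SkewSymmetric b (C a ⊞ E b a a)
  C⊞E-skew = proj₂ (proj₂ (proj₂ isC))

  form-of-C : ∀ a x → b x (x · C a) ≡ b x a
  form-of-C a x = xor≡false⇒≡ _ _ (begin
    b x (x · C a) xor b x a                 ≡⟨ cong (b x (x · C a) xor_) (∧-idem (b x a)) ⟨
    b x (x · C a) xor (b x a ∧ b x a)       ≡⟨ cong (b x (x · C a) xor_) (scaleʳ x (b x a) a) ⟨
    b x (x · C a) xor b x (scale (b x a) a) ≡⟨ additiveʳ x (x · C a) (scale (b x a) a) ⟨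
    b x (x · C a ⊕ scale (b x a) a)         ≡⟨ cong (λ y → b x (x · C a ⊕ y)) (·-E x a a) ⟨
    b x (x · C a ⊕ x · E b a a)             ≡⟨ cong (b x) (vm-⊞ x (C a) (E b a a)) ⟨
    b x (x · (C a ⊞ E b a a))               ≡⟨ proj₂ (C⊞E-skew a) x ⟩
    false                                   ∎)
    where open ≡-Reasoning

  label-by-form : ∀ {L} a c → C a ≡ L → (∀ x → b x (x · L) ≡ b x c) → a ≡ c
  label-by-form a c refl h = ≡-by-form a c λ x → trans (sym (form-of-C a x)) (h x)

  C-𝟎 : C 𝟎 ≡ zeroOp
  C-𝟎 = let a , Ca≡0 = C-surjective zeroOp (SymplecticSpreadSet.hasZero S) in
    subst (λ t → C t ≡ zeroOp)
      (label-by-form a 𝟎 Ca≡0 λ x → cong (b x) (vm-zeroOp x))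
      Ca≡0

  C-additive : ∀ a a' → C (a ⊕ a') ≡ C a ⊞ C a'
  C-additive a a' =
    let c , Cc≡ = C-surjective (C a ⊞ C a') (closed (C a) (C a') (C-∈ a) (C-∈ a')) in
    subst (λ t → C t ≡ C a ⊞ C a') (label-by-form c (a ⊕ a') Cc≡ form-of-sum) Cc≡
    where
    form-of-sum : ∀ x → b x (x · (C a ⊞ C a')) ≡ b x (a ⊕ a')
    form-of-sum x = begin
      b x (x · (C a ⊞ C a'))           ≡⟨ cong (b x) (vm-⊞ x (C a) (C a')) ⟩
      b x (x · C a ⊕ x · C a')         ≡⟨ additiveʳ x (x · C a) (x · C a') ⟩
      b x (x · C a) xor b x (x · C a') ≡⟨ cong₂ _xor_ (form-of-C a x) (form-of-C a' x) ⟩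
      b x a xor b x a'                 ≡⟨ additiveʳ x a a' ⟨
      b x (a ⊕ a')                     ∎
      where open ≡-Reasoning

  ·C-additive : ∀ a a' x → x · C (a ⊕ a') ≡ x · C a ⊕ x · C a'
  ·C-additive a a' x = trans (cong (x ·_) (C-additive a a')) (vm-⊞ x (C a) (C a'))

module CommonShadow (6<n : 6 < n) {b : Vect n → Vect n → Bool} (B : NondegSymBilinear n b)
  {Δ Σ₁ Σ₂ : List (Op n)}
  (S₁ : SymplecticSpreadSet b Σ₁) (closed₁ : AdditivelyClosed b Σ₁) (shadow₁ : IsShadowOf b Δ Σ₁)
  (S₂ : SymplecticSpreadSet b Σ₂) (closed₂ : AdditivelyClosed b Σ₂) (shadow₂ : IsShadowOf b Δ Σ₂)
  where
  open NondegSymBilinearProperties B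

  C₁ C₂ : Vect n → Op n
  C₁ = proj₁ shadow₁
  C₂ = proj₁ shadow₂

  module L₁ = CanonicalLabeling B S₁ closed₁ (proj₁ (proj₂ shadow₁))
  module L₂ = CanonicalLabeling B S₂ closed₂ (proj₁ (proj₂ shadow₂))

  matching : ∀ a → ∃[ p ] C₂ a ⊞ E b a a ≡ C₁ p ⊞ E b p p
  matching a = Equivalence.to (proj₂ (proj₂ shadow₁) (C₂ a ⊞ E b a a))
                 (Equivalence.from (proj₂ (proj₂ shadow₂) (C₂ a ⊞ E b a a)) (a , refl))

  π : Vect n → Vect n
  π a = proj₁ (matching a)

  -- ε t x = x E_{t,t}
  ε : Vect n → Vect n → Vect n
  ε t x = scale (b x t) t

  ψ : Vect n → Vect n → Vect n
  ψ t x = ε t x ⊕ ε (π t) x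

  ·C₁∘π : ∀ t x → x · C₁ (π t) ≡ x · C₂ t ⊕ ψ t x
  ·C₁∘π t x = begin
    x · C₁ (π t)                                 ≡⟨ ⊕-cancelʳ (x · C₁ (π t)) (ε (π t) x) ⟨
    (x · C₁ (π t) ⊕ ε (π t) x) ⊕ ε (π t) x       ≡⟨ cong (_⊕ ε (π t) x) (act (C₁ (π t)) (π t)) ⟨
    x · (C₁ (π t) ⊞ E b (π t) (π t)) ⊕ ε (π t) x ≡⟨ cong (λ M → x · M ⊕ ε (π t) x) (proj₂ (matching t)) ⟨
    x · (C₂ t ⊞ E b t t) ⊕ ε (π t) x             ≡⟨ cong (_⊕ ε (π t) x) (act (C₂ t) t) ⟩
    (x · C₂ t ⊕ ε t x) ⊕ ε (π t) x               ≡⟨ ⊕-assoc (x · C₂ t) (ε t x) (ε (π t) x) ⟩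
    x · C₂ t ⊕ ψ t x                             ∎
    where
    open ≡-Reasoning
    act : ∀ M t → x · (M ⊞ E b t t) ≡ x · M ⊕ ε t x
    act M t = trans (vm-⊞ x M (E b t t)) (cong (x · M ⊕_) (·-E x t t))

  defect : Vect n → Vect n → Vect n
  defect a a' = (π a ⊕ π a') ⊕ π (a ⊕ a')

  ·C₁-defect : ∀ a a' x → x · C₁ (defect a a') ≡ (ψ a x ⊕ ψ a' x) ⊕ ψ (a ⊕ a') x
  ·C₁-defect a a' x = begin
    x · C₁ ((π a ⊕ π a') ⊕ π (a ⊕ a'))
      ≡⟨ L₁.·C-additive (π a ⊕ π a') (π (a ⊕ a')) x ⟩
    x · C₁ (π a ⊕ π a') ⊕ x · C₁ (π (a ⊕ a'))
      ≡⟨ cong (_⊕ x · C₁ (π (a ⊕ a'))) (L₁.·C-additive (π a) (π a') x) ⟩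
    (x · C₁ (π a) ⊕ x · C₁ (π a')) ⊕ x · C₁ (π (a ⊕ a'))
      ≡⟨ cong₂ _⊕_ (cong₂ _⊕_ (·C₁∘π a x) (·C₁∘π a' x)) (·C₁∘π (a ⊕ a') x) ⟩
    ((x · C₂ a ⊕ ψ a x) ⊕ (x · C₂ a' ⊕ ψ a' x)) ⊕ (x · C₂ (a ⊕ a') ⊕ ψ (a ⊕ a') x)
      ≡⟨ ⊕-interchange₃ (x · C₂ a) (ψ a x) (x · C₂ a') (ψ a' x) (x · C₂ (a ⊕ a')) (ψ (a ⊕ a') x) ⟩
    ((x · C₂ a ⊕ x · C₂ a') ⊕ x · C₂ (a ⊕ a')) ⊕ ((ψ a x ⊕ ψ a' x) ⊕ ψ (a ⊕ a') x)
      ≡⟨ cong (_⊕ ((ψ a x ⊕ ψ a' x) ⊕ ψ (a ⊕ a') x))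
              (additive-sum≡𝟎 (x · C₂ a) (x · C₂ a') _ (L₂.·C-additive a a' x)) ⟩
    𝟎 ⊕ ((ψ a x ⊕ ψ a' x) ⊕ ψ (a ⊕ a') x)
      ≡⟨ ⊕-identityˡ _ ⟩
    (ψ a x ⊕ ψ a' x) ⊕ ψ (a ⊕ a') x ∎
    where open ≡-Reasoning

  ψ-orthogonal : ∀ t x → b x t ≡ false → b x (π t) ≡ false → ψ t x ≡ 𝟎
  ψ-orthogonal t x x⊥t x⊥πt = trans (cong₂ (λ β γ → scale β t ⊕ scale γ (π t)) x⊥t x⊥πt) (⊕-identityˡ 𝟎)

  witnesses : Vect n → Vect n → Vec (Vect n) 6
  witnesses a a' = a ∷ π a ∷ a' ∷ π a' ∷ (a ⊕ a') ∷ π (a ⊕ a') ∷ []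

  ψ-sum-orthogonal : ∀ a a' y → All (λ u → b y u ≡ false) (witnesses a a') →
                     (ψ a y ⊕ ψ a' y) ⊕ ψ (a ⊕ a') y ≡ 𝟎
  ψ-sum-orthogonal a a' y (y⊥a ∷ y⊥πa ∷ y⊥a' ∷ y⊥πa' ∷ y⊥a+a' ∷ y⊥π[a+a'] ∷ []) = begin
    (ψ a y ⊕ ψ a' y) ⊕ ψ (a ⊕ a') y
      ≡⟨ cong₂ _⊕_ (cong₂ _⊕_ (ψ-orthogonal a y y⊥a y⊥πa) (ψ-orthogonal a' y y⊥a' y⊥πa'))
                   (ψ-orthogonal (a ⊕ a') y y⊥a+a' y⊥π[a+a']) ⟩
    (𝟎 ⊕ 𝟎) ⊕ 𝟎 ≡⟨ ⊕-identityʳ (𝟎 ⊕ 𝟎) ⟩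
    𝟎 ⊕ 𝟎       ≡⟨ ⊕-identityˡ 𝟎 ⟩
    𝟎           ∎
    where open ≡-Reasoning

  defect≡𝟎 : ∀ a a' → defect a a' ≡ 𝟎
  defect≡𝟎 a a' =
    let y , y≢𝟎 , y⊥ = ∃-nonzero-orthogonal 6<n (witnesses a a')
        y∈ker : y · C₁ (defect a a') ≡ 𝟎
        y∈ker = trans (·C₁-defect a a' y) (ψ-sum-orthogonal a a' y y⊥)
    in L₁.C-injective _ _
         (trans (singular-member≡zeroOp S₁ (L₁.C-∈ (defect a a')) y≢𝟎 y∈ker) (sym L₁.C-𝟎))

  π-additive : ∀ a a' → π (a ⊕ a') ≡ π a ⊕ π a'
  π-additive a a' = sym (⊕≡𝟎⇒≡ _ _ (defect≡𝟎 a a'))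

  π-𝟎 : π 𝟎 ≡ 𝟎
  π-𝟎 = begin
    π 𝟎             ≡⟨ cong π (⊕-self 𝟎) ⟨
    π (𝟎 ⊕ 𝟎)       ≡⟨ π-additive 𝟎 𝟎 ⟩
    π 𝟎 ⊕ π 𝟎       ≡⟨ ⊕-self (π 𝟎) ⟩
    𝟎               ∎
    where open ≡-Reasoning

  ψ-sum≡𝟎 : ∀ a a' x → (ψ a x ⊕ ψ a' x) ⊕ ψ (a ⊕ a') x ≡ 𝟎
  ψ-sum≡𝟎 a a' x = begin
    (ψ a x ⊕ ψ a' x) ⊕ ψ (a ⊕ a') x ≡⟨ ·C₁-defect a a' x ⟨
    x · C₁ (defect a a')            ≡⟨ cong (λ t → x · C₁ t) (defect≡𝟎 a a') ⟩
    x · C₁ 𝟎                        ≡⟨ cong (x ·_) L₁.C-𝟎 ⟩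
    x · zeroOp                      ≡⟨ vm-zeroOp x ⟩
    𝟎                               ∎
    where open ≡-Reasoning

  ε-polarization : ∀ t u x → b x t ≡ false → (ε t x ⊕ ε u x) ⊕ ε (t ⊕ u) x ≡ scale (b x u) t
  ε-polarization t u x x⊥t = begin
    (ε t x ⊕ ε u x) ⊕ ε (t ⊕ u) x
      ≡⟨ cong₂ (λ β γ → (scale β t ⊕ ε u x) ⊕ scale γ (t ⊕ u))
               x⊥t (trans (additiveʳ x t u) (cong (_xor b x u) x⊥t)) ⟩
    (𝟎 ⊕ ε u x) ⊕ scale (b x u) (t ⊕ u)
      ≡⟨ cong₂ _⊕_ (⊕-identityˡ (ε u x)) (scale-⊕ (b x u) t u) ⟩
    ε u x ⊕ (scale (b x u) t ⊕ ε u x)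
      ≡⟨ cong (ε u x ⊕_) (⊕-comm (scale (b x u) t) (ε u x)) ⟩
    ε u x ⊕ (ε u x ⊕ scale (b x u) t)
      ≡⟨ ⊕-cancelˡ (ε u x) (scale (b x u) t) ⟩
    scale (b x u) t ∎
    where open ≡-Reasoning

  π-on-orthogonal : ∀ a a' x → All (λ u → b x u ≡ false) (a ∷ π a ∷ []) → b x a' ≡ true →
                    a ≡ scale (b x (π a')) (π a)
  π-on-orthogonal a a' x (x⊥a ∷ x⊥πa ∷ []) xa'≡true = ⊕≡𝟎⇒≡ a (scale (b x (π a')) (π a)) (begin
    a ⊕ scale (b x (π a')) (π a)
      ≡⟨ cong (λ β → scale β a ⊕ scale (b x (π a')) (π a)) xa'≡true ⟨
    scale (b x a') a ⊕ scale (b x (π a')) (π a)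
      ≡⟨ cong₂ _⊕_ (ε-polarization a a' x x⊥a) (ε-polarization (π a) (π a') x x⊥πa) ⟨
    ((ε a x ⊕ ε a' x) ⊕ ε (a ⊕ a') x) ⊕ ((ε (π a) x ⊕ ε (π a') x) ⊕ ε (π a ⊕ π a') x)
      ≡⟨ cong (λ t → ((ε a x ⊕ ε a' x) ⊕ ε (a ⊕ a') x) ⊕ ((ε (π a) x ⊕ ε (π a') x) ⊕ ε t x))
              (π-additive a a') ⟨
    ((ε a x ⊕ ε a' x) ⊕ ε (a ⊕ a') x) ⊕ ((ε (π a) x ⊕ ε (π a') x) ⊕ ε (π (a ⊕ a')) x)
      ≡⟨ ⊕-interchange₃ (ε a x) (ε (π a) x) (ε a' x) (ε (π a') x) (ε (a ⊕ a') x) (ε (π (a ⊕ a')) x) ⟨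
    (ψ a x ⊕ ψ a' x) ⊕ ψ (a ⊕ a') x
      ≡⟨ ψ-sum≡𝟎 a a' x ⟩
    𝟎 ∎)
    where open ≡-Reasoning

  2<n : 2 < n
  2<n = <-trans (s≤s (s≤s (s≤s z≤n))) 6<n

  π-identity : ∀ a → π a ≡ a
  π-identity a =
    let x , x≢𝟎 , x⊥ = ∃-nonzero-orthogonal 2<n (a ∷ π a ∷ [])
        a' , xa'≡true = ∃-non-orthogonal x x≢𝟎
    in conclude (b x (π a')) (π-on-orthogonal a a' x x⊥ xa'≡true)
    where
    conclude : ∀ β → a ≡ scale β (π a) → π a ≡ a
    conclude true  a≡πa = sym a≡πa
    conclude false a≡𝟎  = trans (cong π a≡𝟎) (trans π-𝟎 (sym a≡𝟎))

  C₂≡C₁ : ∀ a → C₂ a ≡ C₁ a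
  C₂≡C₁ a = ⊞-cancelʳ (C₂ a) (C₁ a) (E b a a)
    (subst (λ p → C₂ a ⊞ E b a a ≡ C₁ p ⊞ E b p p) (π-identity a) (proj₂ (matching a)))

  Σ₂⊆Σ₁ : ∀ {L} → L ∈ Σ₂ → L ∈ Σ₁
  Σ₂⊆Σ₁ L∈Σ₂ = let a , C₂a≡L = L₂.C-surjective _ L∈Σ₂ in
    subst (_∈ Σ₁) (trans (sym (C₂≡C₁ a)) C₂a≡L) (L₁.C-∈ a)

odd∧5<n⇒6<n : n % 2 ≡ 1 → 5 < n → 6 < n
odd∧5<n⇒6<n odd 5<n = ≤∧≢⇒< 5<n λ { refl → 0≢1+n odd }

proposition4p4 : (n : ℕ) → n % 2 ≡ 1 → 5 < n
    → (b : Vect n → Vect n → Bool) → NondegSymBilinear n b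
    → (Δ : List (Op n)) → DHOSet b Δ
    → (Σ₁ Σ₂ : List (Op n))
    → SymplecticSpreadSet b Σ₁ → AdditivelyClosed b Σ₁ → IsShadowOf b Δ Σ₁
    → SymplecticSpreadSet b Σ₂ → AdditivelyClosed b Σ₂ → IsShadowOf b Δ Σ₂
    → (∀ L → (L ∈ Σ₁) ⇔ (L ∈ Σ₂))
proposition4p4 n odd 5<n _ B _ _ _ _ S₁ closed₁ shadow₁ S₂ closed₂ shadow₂ _ =
  mk⇔ (CommonShadow.Σ₂⊆Σ₁ 6<n B S₂ closed₂ shadow₂ S₁ closed₁ shadow₁)
      (CommonShadow.Σ₂⊆Σ₁ 6<n B S₁ closed₁ shadow₁ S₂ closed₂ shadow₂)
  where
  6<n : 6 < n
  6<n = odd∧5<n⇒6<n odd 5<n
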